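{- Let $a,b,n$ be positive integers with $a$ odd and $b\equiv 2\pmod 4$. Then $$t(a,a,b,b;n)=N(a,a,b,b;4n+a+b).$$
   Context: For positive integers $a_1,\dots,a_k$ and a nonnegative integer $n$, $N(a_1,\dots,a_k;n)$ is the number of $(x_1,\dots,x_k)\in\mathbb Z^k$ with $n=a_1x_1^2+\cdots+a_kx_k^2$, and $t(a_1,\dots,a_k;n)$ is the number of $(x_1,\dots,x_k)\in\mathbb Z^k$ with $n=a_1\frac{x_1(x_1-1)}2+\cdots+a_k\frac{x_k(x_k-1)}2$. -}

module Defs where

open import Data.Nat as ℕ using (ℕ; zero; suc)
open import Data.Integer as ℤ using (ℤ; +_; -[1+_])
open import Data.List using (List; []; _∷_; map; concatMap; length; filter)
open import Data.Nat.Divisibility using (_∣_)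
open import Relation.Binary.PropositionalEquality using (_≡_)
import Data.Integer.Properties as ℤP

intRange : ℕ → List ℤ
intRange B = go (suc B)
  where
  go : ℕ → List ℤ
  go zero = []
  go (suc k) = (+ k) ∷ -[1+ k ] ∷ go k

tuples : ℕ → List ℤ → List (List ℤ)
tuples zero xs = [] ∷ []
tuples (suc k) xs = concatMap (λ x → map (x ∷_) (tuples k xs)) xs

weighted : (ℤ → ℤ) → List ℕ → List ℤ → ℤ
weighted f (a ∷ as) (x ∷ xs) = (+ a) ℤ.* f x ℤ.+ weighted f as xs
weighted f _ _ = + 0

square : ℤ → ℤ
square x = x ℤ.* x

-- x(x-1)/2 ; x(x-1) is always even, so the integer division is exact.
tri : ℤ → ℤ
tri x = (x ℤ.* (x ℤ.- + 1)) ℤ./ (+ 2)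

-- Number of solutions (x_1..x_k) ∈ ℤ^k of  m = Σ a_i f(x_i), where every
-- solution is known to satisfy |x_i| ≤ m + 1 (true for f = square and
-- f = tri when all a_i ≥ 1), so the count over the box is the full count.
countSols : (ℤ → ℤ) → List ℕ → ℕ → ℕ
countSols f as m =
  length (filter (λ xs → weighted f as xs ℤ.≟ + m)
                 (tuples (length as) (intRange (suc m))))

N : List ℕ → ℕ → ℕ
N = countSols square

t : List ℕ → ℕ → ℕ
t = countSols tri

-- The substitution (x, y) ↦ (x + y - 1, x - y) satisfies
-- (x + y - 1)² + (x - y)² = 4 (T x + T y) + 1 with T x = x (x - 1) / 2, so applied to both
-- pairs of variables it maps the representations counted by t(a,a,b,b;n) injectively onto
-- the representations (u, v, s, r) counted by N(a,a,b,b;4n+a+b) in which u + v and s + r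
-- are odd. When a is odd and b ≡ 2 (mod 4) every representation is of this kind: if u + v
-- is even then u² + v² is even and the equation forces 2 ∣ a; if u + v is odd then
-- a (u² + v²) ≡ a (mod 4), so an even s + r would give b (s² + r²) ≡ 0 (mod 4) and force 4 ∣ b.
module Submission where

open import Defs

open import Algebra.Bundles using (AbelianGroup)
open import Data.Bool using (Bool; true; false)
open import Data.Integer as ℤ using (ℤ; +_; -[1+_]; ∣_∣; _≟_; _+_; _*_; _-_; -_; _%ℕ_; _/ℕ_)
import Data.Integer.Properties as ℤ
open import Data.Integer.DivMod using (div-pos-is-/ℕ; a≡a%ℕn+[a/ℕn]*n; n%ℕd<d)
open import Data.Integer.Divisibility.Signed using (∣⇒∣ᵤ; ∣ᵤ⇒∣)
  renaming (_∣_ to _∣ℤ_; divides to dividesℤ)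
open import Data.Integer.Tactic.RingSolver using (solve-∀)
open import Data.List using (List; []; _∷_; length; map; filter; concatMap; cartesianProductWith; downFrom; _++_)
open import Data.List.Properties using (length-map; ∷-injective)
open import Data.List.Membership.Propositional using (_∈_)
open import Data.List.Membership.Propositional.Properties
  using (∈-map⁺; ∈-map⁻; ∈-filter⁺; ∈-filter⁻; ∈-downFrom⁺;
         ∈-cartesianProductWith⁺; ∈-cartesianProductWith⁻)
open import Data.List.Membership.Propositional.Properties.WithK using (unique∧set⇒bag)
open import Data.List.Relation.Binary.BagAndSetEquality using (∼bag⇒↭)
open import Data.List.Relation.Binary.Permutation.Propositional.Properties using (↭-length)
open import Data.List.Relation.Unary.All as All using (All; []; _∷_)
open import Data.List.Relation.Unary.AllPairs using ([]; _∷_)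
open import Data.List.Relation.Unary.Any using (here; there)
open import Data.List.Relation.Unary.Unique.Propositional using (Unique)
import Data.List.Relation.Unary.Unique.Propositional.Properties as Unique
open import Data.Nat as ℕ using (ℕ; zero; suc; NonZero; _≤_; z≤n; s≤s; _%_)
import Data.Nat.Properties as ℕ
open import Data.Nat.Combinatorics using (_C_; nC1≡n; nCk+nC[k+1]≡[n+1]C[k+1])
open import Data.Nat.DivMod using (m*n/n≡m)
open import Data.Nat.Divisibility using (_∣_; _∤_; divides; ∣-refl; n∣m⇒m%n≡0; ∣n∣m%n⇒∣m)
open import Data.Nat.ListAction using (sum)
open import Data.Product using (∃-syntax; _×_; _,_)
open import Function.Bundles using (mk⇔)
open import Function.Definitions using (Injective)
open import Relation.Binary.PropositionalEquality
open import Relation.Nullary using (contradiction)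
open import Algebra.Properties.Group (AbelianGroup.group ℤ.+-0-abelianGroup)
  using () renaming (∙-cancelʳ to +-cancelʳ)
open ≡-Reasoning

length-≡-by-bijection : ∀ {A B : Set} {xs : List A} {ys : List B} (F : A → B) → Injective _≡_ _≡_ F →
  Unique xs → Unique ys →
  (∀ {x} → x ∈ xs → F x ∈ ys) → (∀ {y} → y ∈ ys → ∃[ x ] x ∈ xs × F x ≡ y) →
  length xs ≡ length ys
length-≡-by-bijection {xs = xs} {ys} F F-injective xs! ys! into onto = begin
  length xs         ≡⟨ length-map F xs ⟨
  length (map F xs) ≡⟨ ↭-length (∼bag⇒↭ (unique∧set⇒bag image! ys! (mk⇔ image⊆ys ys⊆image))) ⟩
  length ys         ∎
  where
  image! : Unique (map F xs)
  image! = Unique.map⁺ F-injective xs!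
  image⊆ys : ∀ {y} → y ∈ map F xs → y ∈ ys
  image⊆ys y∈ with _ , x∈xs , refl ← ∈-map⁻ F y∈ = into x∈xs
  ys⊆image : ∀ {y} → y ∈ ys → y ∈ map F xs
  ys⊆image y∈ys with _ , x∈xs , refl ← onto y∈ys = ∈-map⁺ F x∈xs

tuples-suc : ∀ k (xs : List ℤ) → tuples (suc k) xs ≡ cartesianProductWith _∷_ xs (tuples k xs)
tuples-suc k xs = concatMap≡cartesianProduct xs
  where
  concatMap≡cartesianProduct : ∀ zs → concatMap (λ z → map (z ∷_) (tuples k xs)) zs
                                      ≡ cartesianProductWith _∷_ zs (tuples k xs)
  concatMap≡cartesianProduct []       = refl
  concatMap≡cartesianProduct (z ∷ zs) = cong (map (z ∷_) (tuples k xs) ++_) (concatMap≡cartesianProduct zs)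

tuples-unique : ∀ k {xs} → Unique xs → Unique (tuples k xs)
tuples-unique zero    xs! = [] ∷ []
tuples-unique (suc k) {xs} xs! rewrite tuples-suc k xs =
  Unique.cartesianProductWith⁺ _∷_ ∷-injective xs! (tuples-unique k xs!)

∈-tuples⁺ : ∀ {xs ys : List ℤ} → All (_∈ ys) xs → xs ∈ tuples (length xs) ys
∈-tuples⁺ []                          = here refl
∈-tuples⁺ {x ∷ xs} {ys} (x∈ys ∷ xs⊆ys) rewrite tuples-suc (length xs) ys =
  ∈-cartesianProductWith⁺ _∷_ x∈ys (∈-tuples⁺ xs⊆ys)

∈-tuples⇒length : ∀ k {xs ys : List ℤ} → xs ∈ tuples k ys → length xs ≡ k
∈-tuples⇒length zero    (here refl) = refl
∈-tuples⇒length (suc k) {_} {ys} xs∈ rewrite tuples-suc k ys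
  with _ , _ , _ , t∈ , refl ← ∈-cartesianProductWith⁻ _∷_ ys (tuples k ys) xs∈ =
  cong suc (∈-tuples⇒length k t∈)

signed : ℕ → Bool → ℤ
signed j true  = + j
signed j false = -[1+ j ]

signed-injective : ∀ {i j s t} → signed i s ≡ signed j t → i ≡ j × s ≡ t
signed-injective {s = true}  {true}  refl = refl , refl
signed-injective {s = false} {false} refl = refl , refl
signed-injective {s = true}  {false} ()
signed-injective {s = false} {true}  ()

intRange-signed : ∀ B → intRange B ≡ cartesianProductWith signed (downFrom (suc B)) (true ∷ false ∷ [])
intRange-signed zero    = refl
intRange-signed (suc B) = cong (λ r → + suc B ∷ -[1+ suc B ] ∷ r) (intRange-signed B)

intRange-unique : ∀ B → Unique (intRange B)
intRange-unique B rewrite intRange-signed B =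
  Unique.cartesianProductWith⁺ signed signed-injective (Unique.downFrom⁺ (suc B))
    (((λ ()) ∷ []) ∷ [] ∷ [])

∣∣≤⇒∈intRange : ∀ {B} z → ∣ z ∣ ≤ B → z ∈ intRange B
∣∣≤⇒∈intRange {B} (+ j) j≤B rewrite intRange-signed B =
  ∈-cartesianProductWith⁺ signed (∈-downFrom⁺ (s≤s j≤B)) (here refl)
∣∣≤⇒∈intRange {B} -[1+ j ] j<B rewrite intRange-signed B =
  ∈-cartesianProductWith⁺ signed (∈-downFrom⁺ (ℕ.m≤n⇒m≤1+n j<B)) (there (here refl))

IsSolution : (ℤ → ℤ) → List ℕ → ℕ → List ℤ → Set
IsSolution f as m xs = length xs ≡ length as × weighted f as xs ≡ + m

solutions : (ℤ → ℤ) → List ℕ → ℕ → List (List ℤ)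
solutions f as m = filter (λ xs → weighted f as xs ≟ + m) (tuples (length as) (intRange (suc m)))

solutions-unique : ∀ f as m → Unique (solutions f as m)
solutions-unique f as m = Unique.filter⁺ _ (tuples-unique (length as) (intRange-unique (suc m)))

∈-solutions⁻ : ∀ {f as m xs} → xs ∈ solutions f as m → IsSolution f as m xs
∈-solutions⁻ {as = as} xs∈ with xs∈tuples , eq ← ∈-filter⁻ _ xs∈ =
  ∈-tuples⇒length (length as) xs∈tuples , eq

-- For these weights the search box [-(m+2), m+1] of countSols contains every solution.
record Coercive (f : ℤ → ℤ) : Set where
  field
    value       : ℤ → ℕ
    f≡value     : ∀ x → f x ≡ + value x
    ∣x∣≤1+value : ∀ x → ∣ x ∣ ≤ suc (value x)

module _ {f : ℤ → ℤ} (f-coercive : Coercive f) where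
  open Coercive f-coercive

  weightedℕ : List ℕ → List ℤ → ℕ
  weightedℕ (a ∷ as) (x ∷ xs) = a ℕ.* value x ℕ.+ weightedℕ as xs
  weightedℕ _        _        = 0

  weighted≡weightedℕ : ∀ as xs → weighted f as xs ≡ + weightedℕ as xs
  weighted≡weightedℕ []       _        = refl
  weighted≡weightedℕ (a ∷ as) []       = refl
  weighted≡weightedℕ (a ∷ as) (x ∷ xs) = begin
    + a * f x + weighted f as xs          ≡⟨ cong₂ (λ v w → + a * v + w) (f≡value x) (weighted≡weightedℕ as xs) ⟩
    + a * + value x + + weightedℕ as xs   ≡⟨ cong (_+ + weightedℕ as xs) (ℤ.pos-* a (value x)) ⟨
    + weightedℕ (a ∷ as) (x ∷ xs)         ∎

  value≤weightedℕ : ∀ {as xs} → All NonZero as → length xs ≡ length as →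
                    All (λ x → value x ≤ weightedℕ as xs) xs
  value≤weightedℕ {[]}     {[]}     []          _   = []
  value≤weightedℕ {a ∷ as} {x ∷ xs} (a≢0 ∷ as≢0) len =
    ℕ.≤-trans (ℕ.m≤n*m (value x) a {{a≢0}}) (ℕ.m≤m+n _ _)
    ∷ All.map (λ le → ℕ.≤-trans le (ℕ.m≤n+m _ _)) (value≤weightedℕ as≢0 (ℕ.suc-injective len))

  ∈-solutions⁺ : ∀ {as m xs} → All NonZero as → IsSolution f as m xs → xs ∈ solutions f as m
  ∈-solutions⁺ {as} {m} {xs} as≢0 (len , eq) =
    ∈-filter⁺ _ (subst (λ k → xs ∈ tuples k (intRange (suc m))) len
                  (∈-tuples⁺ (All.map in-box (value≤weightedℕ as≢0 len)))) eq
    where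
    total : weightedℕ as xs ≡ m
    total = ℤ.+-injective (trans (sym (weighted≡weightedℕ as xs)) eq)
    in-box : ∀ {x} → value x ≤ weightedℕ as xs → x ∈ intRange (suc m)
    in-box {x} le = ∣∣≤⇒∈intRange x (ℕ.≤-trans (∣x∣≤1+value x) (s≤s (subst (value x ≤_) total le)))

countSols-≡ : ∀ {f g as bs m n} → Coercive f → Coercive g → All NonZero as → All NonZero bs →
  (F : List ℤ → List ℤ) → Injective _≡_ _≡_ F →
  (∀ {xs} → IsSolution f as m xs → IsSolution g bs n (F xs)) →
  (∀ {ys} → IsSolution g bs n ys → ∃[ xs ] IsSolution f as m xs × F xs ≡ ys) →
  countSols f as m ≡ countSols g bs n
countSols-≡ {f} {g} {as} {bs} {m} {n} f-coercive g-coercive as≢0 bs≢0 F F-injective into onto =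
  length-≡-by-bijection F F-injective (solutions-unique f as m) (solutions-unique g bs n)
    (λ xs∈ → ∈-solutions⁺ g-coercive bs≢0 (into (∈-solutions⁻ {f} {as} {m} xs∈)))
    (λ ys∈ → let xs , sol , Fxs≡ys = onto (∈-solutions⁻ {g} {bs} {n} ys∈) in
             xs , ∈-solutions⁺ f-coercive as≢0 sol , Fxs≡ys)

n≤1+n*n : ∀ n → n ≤ suc (n ℕ.* n)
n≤1+n*n zero    = z≤n
n≤1+n*n (suc n) = ℕ.m≤n⇒m≤1+n (ℕ.m≤m*n (suc n) (suc n))

square≡∣∣*∣∣ : ∀ x → square x ≡ + (∣ x ∣ ℕ.* ∣ x ∣)
square≡∣∣*∣∣ (+ k)    = sym (ℤ.pos-* k k)
square≡∣∣*∣∣ -[1+ k ] = refl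

square-coercive : Coercive square
square-coercive = record
  { value       = λ x → ∣ x ∣ ℕ.* ∣ x ∣
  ; f≡value     = square≡∣∣*∣∣
  ; ∣x∣≤1+value = λ x → n≤1+n*n ∣ x ∣
  }

triangle : ℤ → ℕ
triangle (+ k)    = k C 2
triangle -[1+ k ] = suc (suc k) C 2

[1+n]C2≡n+nC2 : ∀ n → suc n C 2 ≡ n ℕ.+ n C 2
[1+n]C2≡n+nC2 n = begin
  suc n C 2           ≡⟨ nCk+nC[k+1]≡[n+1]C[k+1] n 1 ⟨
  n C 1 ℕ.+ n C 2     ≡⟨ cong (ℕ._+ n C 2) (nC1≡n n) ⟩
  n ℕ.+ n C 2         ∎

[1+n]C2*2≡[1+n]*n : ∀ n → (suc n C 2) ℕ.* 2 ≡ suc n ℕ.* n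
[1+n]C2*2≡[1+n]*n zero    = refl
[1+n]C2*2≡[1+n]*n (suc n) = begin
  (suc (suc n) C 2) ℕ.* 2            ≡⟨ cong (ℕ._* 2) ([1+n]C2≡n+nC2 (suc n)) ⟩
  (suc n ℕ.+ suc n C 2) ℕ.* 2        ≡⟨ ℕ.*-distribʳ-+ 2 (suc n) _ ⟩
  suc n ℕ.* 2 ℕ.+ (suc n C 2) ℕ.* 2  ≡⟨ cong (suc n ℕ.* 2 ℕ.+_) ([1+n]C2*2≡[1+n]*n n) ⟩
  suc n ℕ.* 2 ℕ.+ suc n ℕ.* n        ≡⟨ ℕ.*-distribˡ-+ (suc n) 2 n ⟨
  suc n ℕ.* suc (suc n)              ≡⟨ ℕ.*-comm (suc n) _ ⟩
  suc (suc n) ℕ.* suc n              ∎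

x*[x-1]≡triangle*2 : ∀ x → x * (x - + 1) ≡ + (triangle x ℕ.* 2)
x*[x-1]≡triangle*2 (+ zero)    = refl
x*[x-1]≡triangle*2 (+ suc k)   = begin
  + suc k * (+ suc k - + 1)      ≡⟨ shift (+ k) ⟩
  + suc k * + k                  ≡⟨ ℤ.pos-* (suc k) k ⟨
  + (suc k ℕ.* k)                ≡⟨ cong +_ ([1+n]C2*2≡[1+n]*n k) ⟨
  + ((suc k C 2) ℕ.* 2)          ∎
  where
  shift : ∀ X → (+ 1 + X) * ((+ 1 + X) - + 1) ≡ (+ 1 + X) * X
  shift = solve-∀
x*[x-1]≡triangle*2 -[1+ k ]    = begin
  -[1+ k ] * (-[1+ k ] - + 1)    ≡⟨ negate (+ suc k) ⟩
  + suc (suc k) * + suc k        ≡⟨ ℤ.pos-* (suc (suc k)) (suc k) ⟨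
  + (suc (suc k) ℕ.* suc k)      ≡⟨ cong +_ ([1+n]C2*2≡[1+n]*n (suc k)) ⟨
  + ((suc (suc k) C 2) ℕ.* 2)    ∎
  where
  negate : ∀ X → (- X) * ((- X) - + 1) ≡ (+ 1 + X) * X
  negate = solve-∀

tri≡triangle : ∀ x → tri x ≡ + triangle x
tri≡triangle x = begin
  tri x                                ≡⟨ cong (ℤ._/ + 2) (x*[x-1]≡triangle*2 x) ⟩
  + (triangle x ℕ.* 2) ℤ./ + 2         ≡⟨ div-pos-is-/ℕ (+ (triangle x ℕ.* 2)) 2 ⟩
  + (triangle x ℕ.* 2 ℕ./ 2)           ≡⟨ cong +_ (m*n/n≡m (triangle x) 2) ⟩
  + triangle x                         ∎

∣x∣≤1+triangle : ∀ x → ∣ x ∣ ≤ suc (triangle x)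
∣x∣≤1+triangle (+ zero)  = z≤n
∣x∣≤1+triangle (+ suc k) = s≤s (subst (k ≤_) (sym ([1+n]C2≡n+nC2 k)) (ℕ.m≤m+n k _))
∣x∣≤1+triangle -[1+ k ]  =
  ℕ.m≤n⇒m≤1+n (subst (suc k ≤_) (sym ([1+n]C2≡n+nC2 (suc k))) (ℕ.m≤m+n (suc k) _))

tri-coercive : Coercive tri
tri-coercive = record { value = triangle ; f≡value = tri≡triangle ; ∣x∣≤1+value = ∣x∣≤1+triangle }

double : List ℕ → List ℕ
double []       = []
double (c ∷ cs) = c ∷ c ∷ double cs

double-nonZero : ∀ {cs} → All NonZero cs → All NonZero (double cs)
double-nonZero []           = []
double-nonZero (c≢0 ∷ cs≢0) = c≢0 ∷ c≢0 ∷ double-nonZero cs≢0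

pairUp : List ℤ → List ℤ
pairUp (x ∷ y ∷ xs) = (x + y - + 1) ∷ (x - y) ∷ pairUp xs
pairUp xs           = xs

length-pairUp : ∀ xs → length (pairUp xs) ≡ length xs
length-pairUp []           = refl
length-pairUp (_ ∷ [])     = refl
length-pairUp (_ ∷ _ ∷ xs) = cong (λ k → suc (suc k)) (length-pairUp xs)

pair-injective : ∀ {x y x′ y′} → x + y - + 1 ≡ x′ + y′ - + 1 → x - y ≡ x′ - y′ → x ≡ x′ × y ≡ y′
pair-injective {x} {y} {x′} {y′} sum≡ difference≡ = x≡x′ , y≡y′
  where
  twice : ∀ x y → + 2 * x ≡ (x + y - + 1) + (x - y) + + 1
  twice = solve-∀
  x≡x′ : x ≡ x′
  x≡x′ = ℤ.*-cancelˡ-≡ (+ 2) x x′ (begin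
    + 2 * x                           ≡⟨ twice x y ⟩
    (x + y - + 1) + (x - y) + + 1     ≡⟨ cong₂ (λ s d → s + d + + 1) sum≡ difference≡ ⟩
    (x′ + y′ - + 1) + (x′ - y′) + + 1 ≡⟨ twice x′ y′ ⟨
    + 2 * x′                          ∎)
  recover : ∀ x y → y ≡ x - (x - y)
  recover = solve-∀
  y≡y′ : y ≡ y′
  y≡y′ = begin
    y              ≡⟨ recover x y ⟩
    x - (x - y)    ≡⟨ cong₂ _-_ x≡x′ difference≡ ⟩
    x′ - (x′ - y′) ≡⟨ recover x′ y′ ⟨
    y′             ∎

pairUp-injective : Injective _≡_ _≡_ pairUp
pairUp-injective {[]}         {[]}           _  = refl
pairUp-injective {_ ∷ []}     {_ ∷ []}       eq = eq
pairUp-injective {x ∷ y ∷ xs} {x′ ∷ y′ ∷ xs′} eq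
  with sum≡ , eq′ ← ∷-injective eq
  with difference≡ , rest≡ ← ∷-injective eq′
  with refl , refl ← pair-injective {x} {y} {x′} {y′} sum≡ difference≡ =
  cong (λ r → x ∷ y ∷ r) (pairUp-injective rest≡)
pairUp-injective {[]}         {_ ∷ []}       ()
pairUp-injective {[]}         {_ ∷ _ ∷ _}    ()
pairUp-injective {_ ∷ []}     {[]}           ()
pairUp-injective {_ ∷ []}     {_ ∷ _ ∷ _}    ()
pairUp-injective {_ ∷ _ ∷ _}  {[]}           ()
pairUp-injective {_ ∷ _ ∷ _}  {_ ∷ []}       ()

x*[x-1]≡tri*2 : ∀ x → x * (x - + 1) ≡ tri x * + 2
x*[x-1]≡tri*2 x = begin
  x * (x - + 1)              ≡⟨ x*[x-1]≡triangle*2 x ⟩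
  + (triangle x ℕ.* 2)       ≡⟨ ℤ.pos-* (triangle x) 2 ⟩
  + triangle x * + 2         ≡⟨ cong (_* + 2) (tri≡triangle x) ⟨
  tri x * + 2                ∎

odd-sum-squares : ∀ x y → square (x + y - + 1) + square (x - y) ≡ + 4 * (tri x + tri y) + + 1
odd-sum-squares x y = begin
  square (x + y - + 1) + square (x - y)                  ≡⟨ expand x y ⟩
  + 2 * (x * (x - + 1)) + + 2 * (y * (y - + 1)) + + 1
    ≡⟨ cong₂ (λ p q → + 2 * p + + 2 * q + + 1) (x*[x-1]≡tri*2 x) (x*[x-1]≡tri*2 y) ⟩
  + 2 * (tri x * + 2) + + 2 * (tri y * + 2) + + 1        ≡⟨ collect (tri x) (tri y) ⟩
  + 4 * (tri x + tri y) + + 1                            ∎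
  where
  expand : ∀ x y → (x + y - + 1) * (x + y - + 1) + (x - y) * (x - y)
                   ≡ + 2 * (x * (x - + 1)) + + 2 * (y * (y - + 1)) + + 1
  expand = solve-∀
  collect : ∀ p q → + 2 * (p * + 2) + + 2 * (q * + 2) + + 1 ≡ + 4 * (p + q) + + 1
  collect = solve-∀

even-sum-squares : ∀ x y → square (x + y) + square (x - y) ≡ + 2 * (square x + square y)
even-sum-squares = expand
  where
  expand : ∀ x y → (x + y) * (x + y) + (x - y) * (x - y) ≡ + 2 * (x * x + y * y)
  expand = solve-∀

weighted-pairUp : ∀ cs xs → length xs ≡ length (double cs) →
  weighted square (double cs) (pairUp xs) ≡ + 4 * weighted tri (double cs) xs + + sum cs
weighted-pairUp []       []           _   = refl
weighted-pairUp (c ∷ cs) (x ∷ y ∷ xs) len = begin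
  γ * square u + (γ * square v + weighted square (double cs) (pairUp xs))
    ≡⟨ cong (λ r → γ * square u + (γ * square v + r)) (weighted-pairUp cs xs len′) ⟩
  γ * square u + (γ * square v + (+ 4 * W + S))
    ≡⟨ regroup γ (square u) (square v) (+ 4 * W + S) ⟩
  γ * (square u + square v) + (+ 4 * W + S)
    ≡⟨ cong (λ q → γ * q + (+ 4 * W + S)) (odd-sum-squares x y) ⟩
  γ * (+ 4 * (tri x + tri y) + + 1) + (+ 4 * W + S)
    ≡⟨ distribute γ (tri x) (tri y) W S ⟩
  + 4 * (γ * tri x + (γ * tri y + W)) + (γ + S)
    ∎
  where
  len′ = ℕ.suc-injective (ℕ.suc-injective len)
  γ = + c
  S = + sum cs
  W = weighted tri (double cs) xs
  u = x + y - + 1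
  v = x - y
  regroup : ∀ γ P Q R → γ * P + (γ * Q + R) ≡ γ * (P + Q) + R
  regroup = solve-∀
  distribute : ∀ γ p q W S → γ * (+ 4 * (p + q) + + 1) + (+ 4 * W + S) ≡ + 4 * (γ * p + (γ * q + W)) + (γ + S)
  distribute = solve-∀

t-double≡N-double : ∀ cs n → All NonZero cs →
  (∀ {ys} → IsSolution square (double cs) (4 ℕ.* n ℕ.+ sum cs) ys → ∃[ xs ] pairUp xs ≡ ys) →
  t (double cs) n ≡ N (double cs) (4 ℕ.* n ℕ.+ sum cs)
t-double≡N-double cs n cs≢0 pairUp-onto =
  countSols-≡ tri-coercive square-coercive (double-nonZero cs≢0) (double-nonZero cs≢0)
    pairUp pairUp-injective image preimage
  where
  4n = + 4 * + n
  4n≡ : + (4 ℕ.* n) ≡ 4n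
  4n≡ = ℤ.pos-* 4 n
  image : ∀ {xs} → IsSolution tri (double cs) n xs →
          IsSolution square (double cs) (4 ℕ.* n ℕ.+ sum cs) (pairUp xs)
  image {xs} (len , eq) = trans (length-pairUp xs) len , (begin
    weighted square (double cs) (pairUp xs)       ≡⟨ weighted-pairUp cs xs len ⟩
    + 4 * weighted tri (double cs) xs + + sum cs  ≡⟨ cong (λ w → + 4 * w + + sum cs) eq ⟩
    4n + + sum cs                                 ≡⟨ cong (_+ + sum cs) 4n≡ ⟨
    + (4 ℕ.* n ℕ.+ sum cs)                        ∎)
  preimage : ∀ {ys} → IsSolution square (double cs) (4 ℕ.* n ℕ.+ sum cs) ys →
             ∃[ xs ] IsSolution tri (double cs) n xs × pairUp xs ≡ ys
  preimage sol@(len , eq) with xs , refl ← pairUp-onto sol =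
    xs , (len′ , ℤ.*-cancelˡ-≡ (+ 4) _ (+ n) (+-cancelʳ (+ sum cs) _ _ 4W+S≡4n+S)) , refl
    where
    len′ : length xs ≡ length (double cs)
    len′ = trans (sym (length-pairUp xs)) len
    4W+S≡4n+S : + 4 * weighted tri (double cs) xs + + sum cs ≡ 4n + + sum cs
    4W+S≡4n+S = begin
      + 4 * weighted tri (double cs) xs + + sum cs  ≡⟨ weighted-pairUp cs xs len′ ⟨
      weighted square (double cs) (pairUp xs)       ≡⟨ eq ⟩
      + (4 ℕ.* n) + + sum cs                        ≡⟨ cong (_+ + sum cs) 4n≡ ⟩
      4n + + sum cs                                 ∎

data PairShape (u v : ℤ) : Set where
  even-sum : ∀ x y → u ≡ x + y       → v ≡ x - y → PairShape u v
  odd-sum  : ∀ x y → u ≡ x + y - + 1 → v ≡ x - y → PairShape u v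

pairShape : ∀ u v → PairShape u v
pairShape u v = shape ((u + v) %ℕ 2) ((u + v) /ℕ 2) (n%ℕd<d (u + v) 2) (a≡a%ℕn+[a/ℕn]*n (u + v) 2)
  where
  isolate : ∀ u v → u ≡ (u + v) - v
  isolate = solve-∀
  recover : ∀ x v → v ≡ x - (x - v)
  recover = solve-∀
  even : ∀ q v → (+ 0 + q * + 2) - v ≡ q + (q - v)
  even = solve-∀
  odd : ∀ q v → (+ 1 + q * + 2) - v ≡ (q + + 1) + (q + + 1 - v) - + 1
  odd = solve-∀
  shape : ∀ r q → r ℕ.< 2 → u + v ≡ + r + q * + 2 → PairShape u v
  shape 0 q _ u+v≡2q =
    even-sum q (q - v) (trans (isolate u v) (trans (cong (_- v) u+v≡2q) (even q v))) (recover q v)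
  shape 1 q _ u+v≡2q+1 =
    odd-sum (q + + 1) (q + + 1 - v) (trans (isolate u v) (trans (cong (_- v) u+v≡2q+1) (odd q v))) (recover (q + + 1) v)
  shape (suc (suc _)) _ (s≤s (s≤s ())) _

at-solution : ∀ {L R c w} → L ≡ R → c + (L - R) ≡ w → c ≡ w
at-solution {R = R} {c} refl c+0≡w = trans (vanish c R) c+0≡w
  where
  vanish : ∀ c R → c ≡ c + (R - R)
  vanish = solve-∀

2∣U⇒2∣A : ∀ {A B U V K P} → + 2 ∣ℤ B → U ≡ + 2 * P →
                A * U + B * V ≡ + 4 * K + (A + B) → + 2 ∣ℤ A
2∣U⇒2∣A {A} {V = V} {K} {P} (dividesℤ β refl) refl eq =
  dividesℤ (A * P + β * V - + 2 * K - β) (at-solution eq (identity A β V K P))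
  where
  identity : ∀ A β V K P → A + (A * (+ 2 * P) + β * + 2 * V - (+ 4 * K + (A + β * + 2)))
                           ≡ (A * P + β * V - + 2 * K - β) * + 2
  identity = solve-∀

4∣U-1∧2∣V⇒4∣B : ∀ {A B U V K P Q} → + 2 ∣ℤ B → U ≡ + 4 * P + + 1 → V ≡ + 2 * Q →
                A * U + B * V ≡ + 4 * K + (A + B) → + 4 ∣ℤ B
4∣U-1∧2∣V⇒4∣B {A} {K = K} {P} {Q} (dividesℤ β refl) refl refl eq =
  dividesℤ (A * P + β * Q - K) (at-solution eq (identity A β K P Q))
  where
  identity : ∀ A β K P Q → β * + 2 + (A * (+ 4 * P + + 1) + β * + 2 * (+ 2 * Q) - (+ 4 * K + (A + β * + 2)))
                           ≡ (A * P + β * Q - K) * + 4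
  identity = solve-∀

aabb-equation : ∀ a b n u v s r →
  weighted square (double (a ∷ b ∷ [])) (u ∷ v ∷ s ∷ r ∷ []) ≡ + (4 ℕ.* n ℕ.+ sum (a ∷ b ∷ [])) →
  + a * (square u + square v) + + b * (square s + square r) ≡ + 4 * + n + (+ a + + b)
aabb-equation a b n u v s r eq = begin
  + a * (square u + square v) + + b * (square s + square r)
    ≡⟨ regroup (+ a) (+ b) u v s r ⟩
  weighted square (double (a ∷ b ∷ [])) (u ∷ v ∷ s ∷ r ∷ [])
    ≡⟨ eq ⟩
  + (4 ℕ.* n) + (+ a + (+ b + + 0))
    ≡⟨ cong₂ (λ k c → k + (+ a + c)) (ℤ.pos-* 4 n) (ℤ.+-identityʳ (+ b)) ⟩
  + 4 * + n + (+ a + + b)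
    ∎
  where
  regroup : ∀ A B u v s r → A * (u * u + v * v) + B * (s * s + r * r)
                            ≡ A * (u * u) + (A * (v * v) + (B * (s * s) + (B * (r * r) + + 0)))
  regroup = solve-∀

aabb-solution⇒pairUp : ∀ {a b n} → 2 ∤ a → 2 ∣ b → 4 ∤ b →
  ∀ {ys} → IsSolution square (double (a ∷ b ∷ [])) (4 ℕ.* n ℕ.+ sum (a ∷ b ∷ [])) ys →
  ∃[ xs ] pairUp xs ≡ ys
aabb-solution⇒pairUp {a} {b} {n} 2∤a 2∣b 4∤b {u ∷ v ∷ s ∷ r ∷ []} (_ , eq)
  with 2∣ℤb ← ∣ᵤ⇒∣ {+ 2} {+ b} 2∣b
  with pairShape u v | pairShape s r | aabb-equation a b n u v s r eq
... | even-sum x y refl refl | _                      | eq′ = contradiction (∣⇒∣ᵤ {+ 2} {+ a} 2∣a) 2∤a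
  where
  2∣a : + 2 ∣ℤ + a
  2∣a = 2∣U⇒2∣A {K = + n} 2∣ℤb (even-sum-squares x y) eq′
... | odd-sum x y refl refl  | even-sum z w refl refl | eq′ = contradiction (∣⇒∣ᵤ {+ 4} {+ b} 4∣b) 4∤b
  where
  4∣b : + 4 ∣ℤ + b
  4∣b = 4∣U-1∧2∣V⇒4∣B {A = + a} {K = + n} {P = tri x + tri y}
          2∣ℤb (odd-sum-squares x y) (even-sum-squares z w) eq′
... | odd-sum x y refl refl  | odd-sum z w refl refl  | _   = x ∷ y ∷ z ∷ w ∷ [] , refl
aabb-solution⇒pairUp _ _ _ {[]}                    (() , _)
aabb-solution⇒pairUp _ _ _ {_ ∷ []}                (() , _)
aabb-solution⇒pairUp _ _ _ {_ ∷ _ ∷ []}            (() , _)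
aabb-solution⇒pairUp _ _ _ {_ ∷ _ ∷ _ ∷ []}        (() , _)
aabb-solution⇒pairUp _ _ _ {_ ∷ _ ∷ _ ∷ _ ∷ _ ∷ _} (() , _)

%≡suc⇒∤ : ∀ {m n r} .{{_ : NonZero n}} → m % n ≡ suc r → n ∤ m
%≡suc⇒∤ {m} {n} m%n≡1+r n∣m = contradiction (trans (sym (n∣m⇒m%n≡0 m n n∣m)) m%n≡1+r) λ ()

theorem5p12 : (a b n : ℕ) → NonZero a → NonZero b → NonZero n →
    a % 2 ≡ 1 → b % 4 ≡ 2 →
    t (a ∷ a ∷ b ∷ b ∷ []) n ≡ N (a ∷ a ∷ b ∷ b ∷ []) (4 ℕ.* n ℕ.+ a ℕ.+ b)
theorem5p12 a b n a≢0 b≢0 _ a%2≡1 b%4≡2 = begin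
  t (double cs) n                       ≡⟨ t-double≡N-double cs n (a≢0 ∷ b≢0 ∷ []) every-solution-pairUp ⟩
  N (double cs) (4 ℕ.* n ℕ.+ sum cs)    ≡⟨ cong (N (double cs)) 4n+sum≡4n+a+b ⟩
  N (double cs) (4 ℕ.* n ℕ.+ a ℕ.+ b)   ∎
  where
  cs = a ∷ b ∷ []
  2∣b : 2 ∣ b
  2∣b = ∣n∣m%n⇒∣m {4} (divides 2 refl) (subst (2 ∣_) (sym b%4≡2) ∣-refl)
  every-solution-pairUp : ∀ {ys} → IsSolution square (double cs) (4 ℕ.* n ℕ.+ sum cs) ys → ∃[ xs ] pairUp xs ≡ ys
  every-solution-pairUp = aabb-solution⇒pairUp {n = n} (%≡suc⇒∤ a%2≡1) 2∣b (%≡suc⇒∤ b%4≡2)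
  4n+sum≡4n+a+b : 4 ℕ.* n ℕ.+ sum cs ≡ 4 ℕ.* n ℕ.+ a ℕ.+ b
  4n+sum≡4n+a+b = trans (cong (λ k → 4 ℕ.* n ℕ.+ (a ℕ.+ k)) (ℕ.+-identityʳ b)) (sym (ℕ.+-assoc (4 ℕ.* n) a b))
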